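{- Let $(G,v)$ be a pointed finite simple graph and $e$ an edge of $G$ incident to $v$. Then $X_{G,v}=X_{G\setminus e,v}-t\,X_{G/e,v}$, where $G\setminus e$ is $G$ with $e$ deleted and $G/e$ is the simple graph obtained by contracting $e$ (merging parallel edges), with distinguished vertex the image of $v$.
   Context: For a graph $G$, $S\subseteq E(G)$ and vertex $v$: $G_S$ is the graph with vertex set $V(G)$ and edge set $S$; $\mathrm{type}_v^-(G_S)$ is the partition of the sizes of the connected components of $G_S$ not containing $v$, and $\mathrm{type}_v^+(G_S)$ the size of the component containing $v$. The pointed chromatic symmetric function is $X_{G,v}=\sum_{S\subseteq E(G)}(-1)^{|S|}p_{\mathrm{type}_v^-(G_S)}t^{\mathrm{type}_v^+(G_S)-1}\in\Lambda[t]$, with $\Lambda$ the ring of symmetric functions and $p_\lambda$ power sums. -}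

module Defs where

open import Level using (Level)
open import Data.Nat as ℕ using (ℕ; zero; suc; _∸_)
open import Data.Fin as F using (Fin; toℕ; punchOut)
open import Data.Bool using (Bool; true; false; _∧_; _∨_; not; if_then_else_)
open import Data.Bool.Properties using (∨-comm; ∧-comm; ∨-identityʳ; ∨-zeroʳ; ∧-zeroʳ)
open import Data.List using (allFin; List; []; _∷_; _++_; map; foldr; concatMap; length)
open import Data.Bool.ListAction using (any)
open import Data.List using () renaming ([_] to singleton)
open import Data.Product using (_×_; _,_)
open import Algebra.Bundles using (CommutativeRing)
open import Relation.Binary.PropositionalEquality using (_≡_; _≢_; refl; sym; cong; trans)
open import Relation.Nullary using (yes; no; ¬_)
open import Relation.Nullary.Decidable using (⌊_⌋)
open import Data.Empty using (⊥-elim)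

record Graph (n : ℕ) : Set where
  field
    adj     : Fin n → Fin n → Bool
    adj-sym : ∀ x y → adj x y ≡ adj y x
    adj-irr : ∀ x → adj x x ≡ false
open Graph public

_==_ : ∀ {n} → Fin n → Fin n → Bool
x == y = ⌊ x F.≟ y ⌋

==-sym : ∀ {n} (x y : Fin n) → (x == y) ≡ (y == x)
==-sym x y with x F.≟ y | y F.≟ x
... | yes _ | yes _ = refl
... | no _  | no _  = refl
... | yes p | no q  = ⊥-elim (q (sym p))
... | no p  | yes q = ⊥-elim (p (sym q))

==-refl : ∀ {n} (x : Fin n) → (x == x) ≡ true
==-refl x with x F.≟ x
... | yes _ = refl
... | no q  = ⊥-elim (q refl)

edges : ∀ {n} → Graph n → List (Fin n × Fin n)
edges {n} G =
  concatMap (λ i → concatMap (λ j →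
      if (toℕ i ℕ.<ᵇ toℕ j) ∧ adj G i j then singleton (i , j) else [])
    (allFin n)) (allFin n)

sublists : ∀ {a} {A : Set a} → List A → List (List A)
sublists []       = singleton []
sublists (x ∷ xs) = sublists xs ++ map (x ∷_) (sublists xs)

adjS : ∀ {n} → List (Fin n × Fin n) → Fin n → Fin n → Bool
adjS S x y = any (λ { (a , b) → ((a == x) ∧ (b == y)) ∨ ((a == y) ∧ (b == x)) }) S

reach : ∀ {n} → List (Fin n × Fin n) → ℕ → Fin n → Fin n → Bool
reach S zero    u w = u == w
reach {n} S (suc k) u w =
  reach S k u w ∨ any (λ x → reach S k u x ∧ adjS S x w) (allFin n)

-- u and w lie in the same connected component of G_S
-- (a walk of length ≤ n suffices in a graph on n vertices)
conn : ∀ {n} → List (Fin n × Fin n) → Fin n → Fin n → Bool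
conn {n} S u w = reach S n u w

compSize : ∀ {n} → List (Fin n × Fin n) → Fin n → ℕ
compSize {n} S u = foldr (λ w acc → (if conn S u w then 1 else 0) ℕ.+ acc) 0 (allFin n)

isRep : ∀ {n} → List (Fin n × Fin n) → Fin n → Bool
isRep {n} S r = not (any (λ w → (toℕ w ℕ.<ᵇ toℕ r) ∧ conn S r w) (allFin n))

-- The pointed chromatic symmetric function X_{G,v}, written in the
-- power-sum basis: it is the polynomial in p_1, p_2, ..., t
--   Σ_S (-1)^{|S|} p_{type_v^-(G_S)} t^{type_v^+(G_S) - 1},
-- p_λ = Π_i p_{λ_i}.  We evaluate it in an arbitrary commutative ring R
-- at arbitrary values p : ℕ → R of the power sums p_1, p_2, … and t : R.

module _ {c ℓ : Level} (R : CommutativeRing c ℓ) where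
  open CommutativeRing R

  pow : Carrier → ℕ → Carrier
  pow x zero    = 1#
  pow x (suc k) = x * pow x k

  sgn : ℕ → Carrier
  sgn zero    = 1#
  sgn (suc k) = - sgn k

  pType⁻ : ∀ {n} → (ℕ → Carrier) → List (Fin n × Fin n) → Fin n → Carrier
  pType⁻ {n} p S v =
    foldr (λ r acc → (if isRep S r ∧ not (conn S v r) then p (compSize S r) else 1#) * acc)
          1# (allFin n)

  X : (p : ℕ → Carrier) (t : Carrier) → ∀ {n} → Graph n → Fin n → Carrier
  X p t G v =
    foldr (λ S acc → (sgn (length S) * (pType⁻ p S v * pow t (compSize S v ∸ 1))) + acc)
          0# (sublists (edges G))

isEdge : ∀ {n} → Fin n → Fin n → Fin n → Fin n → Bool
isEdge v w x y = ((x == v) ∧ (y == w)) ∨ ((x == w) ∧ (y == v))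

delete : ∀ {n} → Graph n → Fin n → Fin n → Graph n
delete G v w = record
  { adj     = λ x y → adj G x y ∧ not (isEdge v w x y)
  ; adj-sym = λ x y → cong₂' (adj-sym G x y) (isEdge-sym x y)
  ; adj-irr = λ x → cong (λ b → b ∧ not (isEdge v w x x)) (adj-irr G x)
  }
  where
  cong₂' : ∀ {a b c d : Bool} → a ≡ b → c ≡ d → a ∧ not c ≡ b ∧ not d
  cong₂' refl refl = refl
  swap4 : ∀ a b c d → (a ∧ b) ∨ (c ∧ d) ≡ (d ∧ c) ∨ (b ∧ a)
  swap4 false b c d = trans (∧-comm c d) (sym (trans (cong (λ z → (d ∧ c) ∨ z) (∧-zeroʳ b)) (∨-identityʳ (d ∧ c))))
  swap4 true false c d = trans (∧-comm c d) (sym (∨-identityʳ (d ∧ c)))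
  swap4 true true c d = sym (∨-zeroʳ (d ∧ c))
  isEdge-sym : ∀ x y → isEdge v w x y ≡ isEdge v w y x
  isEdge-sym x y = swap4 (x == v) (y == w) (x == w) (y == v)

-- Contraction G / e of the edge e = {v,w} (v ≠ w), as a simple graph:
-- w is merged into v, loops are removed and parallel edges merged.

adj⇒≢ : ∀ {n} (G : Graph n) {v w : Fin n} → adj G v w ≡ true → v ≢ w
adj⇒≢ G {v} e refl with adj G v v | adj-irr G v
adj⇒≢ G {v} () refl | .false | refl

-- the quotient map Fin (suc m) → Fin m identifying w with v
quot : ∀ {m} (v w : Fin (suc m)) → v ≢ w → Fin (suc m) → Fin m
quot v w v≢w u with u F.≟ w
... | yes _   = punchOut {i = w} {j = v} (λ eq → v≢w (sym eq))
... | no u≢w  = punchOut {i = w} {j = u} (λ eq → u≢w (sym eq))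

contract : ∀ {m} (G : Graph (suc m)) (v w : Fin (suc m)) → adj G v w ≡ true → Graph m
contract {m} G v w e = record
  { adj     = A
  ; adj-sym = λ a b → sy a b
  ; adj-irr = λ a → ir a
  }
  where
  π = quot v w (adj⇒≢ G e)
  H : Fin m → Fin m → Bool
  H a b = any (λ x → any (λ y → adj G x y ∧ ((π x == a) ∧ (π y == b)))
                         (allFin (suc m))) (allFin (suc m))
  A : Fin m → Fin m → Bool
  A a b = not (a == b) ∧ (H a b ∨ H b a)
  sy : ∀ a b → A a b ≡ A b a
  sy a b with (a == b) | (b == a) | ==-sym a b | H a b | H b a
  ... | x | .x | refl | h1 | h2 = cong (λ z → not x ∧ z) (∨-comm h1 h2)
  ir : ∀ a → A a a ≡ false
  ir a with (a == a) | ==-refl a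
  ... | .true | refl = refl

-- Expanding X_{G,v} over the edge subsets S writes it as an alternating sum Ψ ∅ E(G) of the
-- weights of the connectivity relations of G_S, where Ψ A (x ∷ L) = Ψ A L − Ψ (A ∪ x) L.
-- Ψ A L only depends on the edges of L up to replacing one by another that has the same
-- connectivity over A, and on duplicates not at all.  Hence
-- Ψ ∅ E(G) = Ψ ∅ (e ∷ E(G ∖ e)) = X_{G∖e,v} − Ψ {e} E(G ∖ e), and over {e} every edge of
-- G ∖ e may be replaced by its image in G / e.  A partition joining v and w then has the
-- weight of its image in G / e times t: the block of v gains exactly w.

module Submission where

open import Defs
open import Level using (Level)
open import Algebra.Bundles using (CommutativeRing; CommutativeMonoid)
import Algebra.Properties.CommutativeSemigroup
open import Data.Bool as Bool using (Bool; true; false; _∧_; _∨_; not; if_then_else_)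
import Data.Bool.Properties as BoolP
open import Data.Bool.ListAction using (any)
open import Data.Empty using (⊥-elim)
open import Data.Fin as Fin using (Fin; toℕ; punchIn)
import Data.Fin.Properties as FinP
open import Data.List using (List; []; _∷_; _++_; map; foldr; length; tabulate; allFin)
import Data.List.Properties as ListP
open import Data.List.Membership.Propositional using (_∈_; lose)
import Data.List.Membership.Propositional.Properties as ∈P
open import Data.List.Relation.Unary.Any as Any using (here; there)
open import Data.Maybe using (nothing)
open import Data.Nat as ℕ using (ℕ; zero; suc; _∸_; _≤_; _<_; z≤n; s≤s)
import Data.Nat.Properties as ℕP
open import Data.Product using (∃-syntax; _×_; _,_)
open import Data.Sum using (_⊎_; inj₁; inj₂; [_,_])
open import Function using (_∘_; id)
open import Function.Bundles using (Equivalence)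
open import Relation.Binary.Core using (_⇒_)
open import Relation.Binary.Definitions using (tri<; tri≈; tri>)
open import Relation.Binary.Construct.Closure.ReflexiveTransitive
  using (Star; ε; _◅_; _◅◅_; _⋆; reverse; foldl; kleisliStar; return)
open import Relation.Binary.PropositionalEquality
  using (_≡_; _≢_; refl; sym; trans; cong; cong₂; subst; module ≡-Reasoning)
import Relation.Binary.Reasoning.Setoid
open import Relation.Nullary using (yes; no)
open import Tactic.RingSolver using (solve-∀)
open import Tactic.RingSolver.Core.AlmostCommutativeRing using (AlmostCommutativeRing; fromCommutativeRing)

∨-introˡ : ∀ {x} y → x ≡ true → x ∨ y ≡ true
∨-introˡ y refl = refl

∨-introʳ : ∀ x {y} → y ≡ true → x ∨ y ≡ true
∨-introʳ false refl = refl
∨-introʳ true  refl = refl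

∨-elim : ∀ x {y} → x ∨ y ≡ true → x ≡ true ⊎ y ≡ true
∨-elim true  _ = inj₁ refl
∨-elim false e = inj₂ e

∧-intro : ∀ {x y} → x ≡ true → y ≡ true → x ∧ y ≡ true
∧-intro refl refl = refl

∧-elimˡ : ∀ x {y} → x ∧ y ≡ true → x ≡ true
∧-elimˡ x {y} = BoolP.∧-conicalˡ x y

∧-elimʳ : ∀ x {y} → x ∧ y ≡ true → y ≡ true
∧-elimʳ x {y} = BoolP.∧-conicalʳ x y

bool-ext : ∀ {x y : Bool} → (x ≡ true → y ≡ true) → (y ≡ true → x ≡ true) → x ≡ y
bool-ext {false} {false} _ _ = refl
bool-ext {false} {true}  _ g = g refl
bool-ext {true}  {false} f _ = sym (f refl)
bool-ext {true}  {true}  _ _ = refl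

false≢true : false ≢ true
false≢true ()

implication-≢ : ∀ {x y : Bool} → (y ≡ true → x ≡ true) → x ≢ y → x ≡ true × y ≡ false
implication-≢ {false} {false} _ x≢y = ⊥-elim (x≢y refl)
implication-≢ {false} {true}  y⇒x _ = ⊥-elim (false≢true (y⇒x refl))
implication-≢ {true}  {false} _ _   = refl , refl
implication-≢ {true}  {true}  _ x≢y = ⊥-elim (x≢y refl)

T⇒≡ : ∀ {x} → Bool.T x → x ≡ true
T⇒≡ = Equivalence.to BoolP.T-≡

==⇒≡ : ∀ {n} {a b : Fin n} → (a == b) ≡ true → a ≡ b
==⇒≡ {a = a} {b} e with a Fin.≟ b
... | yes a≡b = a≡b
... | no  _   = ⊥-elim (false≢true e)

≢⇒== : ∀ {n} {a b : Fin n} → a ≢ b → (a == b) ≡ false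
≢⇒== {a = a} {b} a≢b with a Fin.≟ b
... | yes a≡b = ⊥-elim (a≢b a≡b)
... | no  _   = refl

any-intro : ∀ {a} {A : Set a} (f : A → Bool) {x xs} → x ∈ xs → f x ≡ true → any f xs ≡ true
any-intro f {xs = _ ∷ ys} (here refl) e = ∨-introˡ (any f ys) e
any-intro f {xs = y ∷ _}  (there x∈)  e = ∨-introʳ (f y) (any-intro f x∈ e)

any-elim : ∀ {a} {A : Set a} (f : A → Bool) xs → any f xs ≡ true → ∃[ x ] f x ≡ true
any-elim f (y ∷ ys) e with ∨-elim (f y) e
... | inj₁ fy = y , fy
... | inj₂ e′ = any-elim f ys e′

any-cong : ∀ {a} {A : Set a} {f g : A → Bool} → (∀ x → f x ≡ g x) → ∀ xs → any f xs ≡ any g xs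
any-cong f≗g []       = refl
any-cong f≗g (x ∷ xs) = cong₂ _∨_ (f≗g x) (any-cong f≗g xs)

-- Relations on Fin n, paths and connectivity

BoolRel : ℕ → Set
BoolRel n = Fin n → Fin n → Bool

_∪_ : ∀ {n} → BoolRel n → BoolRel n → BoolRel n
(A ∪ B) a b = A a b ∨ B a b

∅ : ∀ {n} → BoolRel n
∅ _ _ = false

SymmetricRel : ∀ {n} → BoolRel n → Set
SymmetricRel A = ∀ a b → A a b ≡ A b a

_≗₂_ : ∀ {n} → BoolRel n → BoolRel n → Set
A ≗₂ B = ∀ a b → A a b ≡ B a b

∪-swapʳ : ∀ {n} (A B C : BoolRel n) → ((A ∪ B) ∪ C) ≗₂ ((A ∪ C) ∪ B)
∪-swapʳ A B C a b = xy∙z≈xz∙y (A a b) (B a b) (C a b)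
  where open Algebra.Properties.CommutativeSemigroup (CommutativeMonoid.commutativeSemigroup BoolP.∨-commutativeMonoid)

-- adjS S is definitionally the union of the edgeRel x, x ∈ S
edgeRel : ∀ {n} → Fin n × Fin n → BoolRel n
edgeRel (i , j) a b = ((i == a) ∧ (j == b)) ∨ ((i == b) ∧ (j == a))

edgeRel-elim : ∀ {n} {i j a b : Fin n} → edgeRel (i , j) a b ≡ true → (i ≡ a × j ≡ b) ⊎ (i ≡ b × j ≡ a)
edgeRel-elim {i = i} {j} {a} {b} e with ∨-elim ((i == a) ∧ (j == b)) e
... | inj₁ q = inj₁ (==⇒≡ (∧-elimˡ (i == a) q) , ==⇒≡ (∧-elimʳ (i == a) q))
... | inj₂ q = inj₂ (==⇒≡ (∧-elimˡ (i == b) q) , ==⇒≡ (∧-elimʳ (i == b) q))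

edgeRel-introˡ : ∀ {n} (i j : Fin n) → edgeRel (i , j) i j ≡ true
edgeRel-introˡ i j = ∨-introˡ _ (∧-intro (==-refl i) (==-refl j))

edgeRel-introʳ : ∀ {n} (i j : Fin n) → edgeRel (i , j) j i ≡ true
edgeRel-introʳ i j = ∨-introʳ ((i == j) ∧ (j == i)) (∧-intro (==-refl i) (==-refl j))

edgeRel-sym : ∀ {n} (x : Fin n × Fin n) → SymmetricRel (edgeRel x)
edgeRel-sym (i , j) a b = BoolP.∨-comm ((i == a) ∧ (j == b)) ((i == b) ∧ (j == a))

edgeRel-flip : ∀ {n} (i j : Fin n) → edgeRel (i , j) ≗₂ edgeRel (j , i)
edgeRel-flip i j a b = bool-ext (flip-edge i j) (flip-edge j i)
  where
  flip-edge : ∀ i j → edgeRel (i , j) a b ≡ true → edgeRel (j , i) a b ≡ true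
  flip-edge i j e with edgeRel-elim {i = i} {j} e
  ... | inj₁ (refl , refl) = edgeRel-introʳ j i
  ... | inj₂ (refl , refl) = edgeRel-introˡ j i

edgeRel-map : ∀ {n k} (f : Fin n → Fin k) {i j a b} → edgeRel (i , j) a b ≡ true → edgeRel (f i , f j) (f a) (f b) ≡ true
edgeRel-map f {i} {j} {a} {b} e with edgeRel-elim {i = i} {j} {a} {b} e
... | inj₁ (refl , refl) = edgeRel-introˡ (f i) (f j)
... | inj₂ (refl , refl) = edgeRel-introʳ (f i) (f j)

Edge : ∀ {n} → BoolRel n → Fin n → Fin n → Set
Edge A a b = A a b ≡ true

Path : ∀ {n} → BoolRel n → Fin n → Fin n → Set
Path A = Star (Edge A)

_⊆*_ : ∀ {n} → BoolRel n → BoolRel n → Set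
A ⊆* B = Edge A ⇒ Path B

_≃*_ : ∀ {n} → BoolRel n → BoolRel n → Set
A ≃* B = A ⊆* B × B ⊆* A

module _ {n : ℕ} where

  Path-sym : {A : BoolRel n} → SymmetricRel A → ∀ {a b} → Path A a b → Path A b a
  Path-sym sym-A = reverse λ {a} {b} e → trans (sym-A b a) e

  ⊆*-trans : {A B C : BoolRel n} → A ⊆* B → B ⊆* C → A ⊆* C
  ⊆*-trans A⊆B B⊆C = (B⊆C ⋆) ∘ A⊆B

  ≗₂⇒⊆* : {A B : BoolRel n} → A ≗₂ B → A ⊆* B
  ≗₂⇒⊆* A≗B {a} {b} e = return (trans (sym (A≗B a b)) e)

  ≗₂⇒≃* : {A B : BoolRel n} → A ≗₂ B → A ≃* B
  ≗₂⇒≃* A≗B = ≗₂⇒⊆* A≗B , ≗₂⇒⊆* (λ a b → sym (A≗B a b))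

  ⊆*-∪ˡ : (A B : BoolRel n) → A ⊆* (A ∪ B)
  ⊆*-∪ˡ A B {a} {b} e = return (∨-introˡ (B a b) e)

  ⊆*-∪ʳ : (A B : BoolRel n) → B ⊆* (A ∪ B)
  ⊆*-∪ʳ A B {a} {b} e = return (∨-introʳ (A a b) e)

  ∪-⊆* : {A B C : BoolRel n} → A ⊆* C → B ⊆* C → (A ∪ B) ⊆* C
  ∪-⊆* {A} A⊆C B⊆C {a} {b} e = [ A⊆C , B⊆C ] (∨-elim (A a b) e)

  ∪-cong-≃* : {A B : BoolRel n} (C : BoolRel n) → A ≃* B → (A ∪ C) ≃* (B ∪ C)
  ∪-cong-≃* {A} {B} C (A⊆B , B⊆A) =
    ∪-⊆* (⊆*-trans A⊆B (⊆*-∪ˡ B C)) (⊆*-∪ʳ B C) ,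
    ∪-⊆* (⊆*-trans B⊆A (⊆*-∪ˡ A C)) (⊆*-∪ʳ A C)

  -- A ∪ x and A ∪ y have the same connectivity
  _∼⟨_⟩_ : BoolRel n → BoolRel n → BoolRel n → Set
  x ∼⟨ A ⟩ y = y ⊆* (A ∪ x) × x ⊆* (A ∪ y)

  ∼-refl : {A x : BoolRel n} → x ∼⟨ A ⟩ x
  ∼-refl {A} {x} = ⊆*-∪ʳ A x , ⊆*-∪ʳ A x

  ∼-sym : {A x y : BoolRel n} → x ∼⟨ A ⟩ y → y ∼⟨ A ⟩ x
  ∼-sym (y⊆ , x⊆) = x⊆ , y⊆

  ≗₂⇒∼ : {A x y : BoolRel n} → x ≗₂ y → x ∼⟨ A ⟩ y
  ≗₂⇒∼ {A} {x} {y} x≗y =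
    ⊆*-trans (≗₂⇒⊆* (λ a b → sym (x≗y a b))) (⊆*-∪ʳ A x) ,
    ⊆*-trans (≗₂⇒⊆* x≗y) (⊆*-∪ʳ A y)

  ∼-respʳ : {A x y y′ : BoolRel n} → y ≗₂ y′ → x ∼⟨ A ⟩ y → x ∼⟨ A ⟩ y′
  ∼-respʳ {A} {x} {y} {y′} y≗y′ (y⊆ , x⊆) =
    ⊆*-trans (≗₂⇒⊆* (λ a b → sym (y≗y′ a b))) y⊆ ,
    ⊆*-trans x⊆ (∪-⊆* (⊆*-∪ˡ A y′) (⊆*-trans (≗₂⇒⊆* y≗y′) (⊆*-∪ʳ A y′)))

  ∼-respˡ : {A x x′ y : BoolRel n} → x ≗₂ x′ → x ∼⟨ A ⟩ y → x′ ∼⟨ A ⟩ y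
  ∼-respˡ x≗x′ = ∼-sym ∘ ∼-respʳ x≗x′ ∘ ∼-sym

  Covers : BoolRel n → List (BoolRel n) → List (BoolRel n) → Set
  Covers A L M = ∀ {y} → y ∈ M → ∃[ x ] x ∈ L × x ∼⟨ A ⟩ y

reachA : ∀ {n} → BoolRel n → ℕ → Fin n → Fin n → Bool
reachA A zero    u w = u == w
reachA {n} A (suc k) u w = reachA A k u w ∨ any (λ x → reachA A k u x ∧ A x w) (allFin n)

reach≡reachA : ∀ {n} (S : List (Fin n × Fin n)) k u w → reach S k u w ≡ reachA (adjS S) k u w
reach≡reachA S zero    u w = refl
reach≡reachA {n} S (suc k) u w =
  cong₂ _∨_ (reach≡reachA S k u w)
            (any-cong (λ x → cong (_∧ adjS S x w) (reach≡reachA S k u x)) (allFin n))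

connected : ∀ {n} → BoolRel n → BoolRel n
connected {n} A = reachA A n

module _ {n : ℕ} (A : BoolRel n) where

  reachA⇒Path : ∀ k {u w} → reachA A k u w ≡ true → Path A u w
  reachA⇒Path zero    e with ==⇒≡ e
  ... | refl = ε
  reachA⇒Path (suc k) {u} {w} e with ∨-elim (reachA A k u w) e
  ... | inj₁ r = reachA⇒Path k r
  ... | inj₂ r with any-elim _ (allFin n) r
  ...   | x , r′ = reachA⇒Path k (∧-elimˡ (reachA A k u x) r′) ◅◅ return (∧-elimʳ (reachA A k u x) r′)

  Path⇒reachA : ∀ {u w} → Path A u w → ∃[ k ] reachA A k u w ≡ true
  Path⇒reachA = foldl (λ u w → ∃[ k ] reachA A k u w ≡ true) extend (λ {u} → 0 , ==-refl u)
    where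
    extend : ∀ {u x w} → ∃[ k ] reachA A k u x ≡ true → A x w ≡ true → ∃[ k ] reachA A k u w ≡ true
    extend {u} {x} {w} (k , r) e =
      suc k , ∨-introʳ (reachA A k u w) (any-intro (λ y → reachA A k u y ∧ A y w) (∈P.∈-allFin x) (∧-intro r e))

  reachA-+ : ∀ j {k u w} → reachA A k u w ≡ true → reachA A (j ℕ.+ k) u w ≡ true
  reachA-+ zero    r = r
  reachA-+ (suc j) r = ∨-introˡ _ (reachA-+ j r)

bit : Bool → ℕ
bit b = if b then 1 else 0

bit-mono : ∀ {b c} → (b ≡ true → c ≡ true) → bit b ≤ bit c
bit-mono {false} _   = z≤n
bit-mono {true}  b⇒c rewrite b⇒c refl = ℕP.≤-refl

countᵇ : ∀ {a} {X : Set a} → (X → Bool) → List X → ℕ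
countᵇ f = foldr (λ x acc → bit (f x) ℕ.+ acc) 0

module _ {a} {X : Set a} where

  countᵇ-mono : {f g : X → Bool} → (∀ x → f x ≡ true → g x ≡ true) → ∀ xs → countᵇ f xs ≤ countᵇ g xs
  countᵇ-mono f⇒g []       = z≤n
  countᵇ-mono f⇒g (x ∷ xs) = ℕP.+-mono-≤ (bit-mono (f⇒g x)) (countᵇ-mono f⇒g xs)

  countᵇ-mono-< : {f g : X → Bool} → (∀ x → f x ≡ true → g x ≡ true) →
                  ∀ {x xs} → x ∈ xs → f x ≡ false → g x ≡ true → countᵇ f xs < countᵇ g xs
  countᵇ-mono-< f⇒g {xs = _ ∷ xs} (here refl) fx gx rewrite fx | gx = s≤s (countᵇ-mono f⇒g xs)
  countᵇ-mono-< f⇒g {xs = y ∷ xs} (there x∈)  fx gx =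
    ℕP.+-mono-≤-< (bit-mono (f⇒g y)) (countᵇ-mono-< f⇒g x∈ fx gx)

  countᵇ≤length : ∀ (f : X → Bool) xs → countᵇ f xs ≤ length xs
  countᵇ≤length f []       = z≤n
  countᵇ≤length f (x ∷ xs) with f x
  ... | true  = s≤s (countᵇ≤length f xs)
  ... | false = ℕP.m≤n⇒m≤1+n (countᵇ≤length f xs)

  countᵇ-pos : ∀ (f : X → Bool) {x xs} → x ∈ xs → f x ≡ true → 0 < countᵇ f xs
  countᵇ-pos f {xs = _ ∷ xs} (here refl) fx rewrite fx = s≤s z≤n
  countᵇ-pos f {xs = y ∷ xs} (there x∈)  fx = ℕP.<-≤-trans (countᵇ-pos f x∈ fx) (ℕP.m≤n+m _ _)

-- The set reached within k steps grows strictly until it stops changing, so it is stable from k = n on.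
module Stabilisation {n} (A : BoolRel n) (u : Fin n) where

  Stable : ℕ → Set
  Stable k = ∀ w → reachA A (suc k) u w ≡ reachA A k u w

  stable-suc : ∀ {k} → Stable k → Stable (suc k)
  stable-suc st w = cong₂ _∨_ (st w) (any-cong (λ x → cong (_∧ A x w) (st x)) (allFin n))

  stable-+ : ∀ {k} → Stable k → ∀ j → Stable (j ℕ.+ k)
  stable-+ st zero    = st
  stable-+ {k} st (suc j) = stable-suc {j ℕ.+ k} (stable-+ st j)

  stable-≡ : ∀ {k} → Stable k → ∀ j w → reachA A (j ℕ.+ k) u w ≡ reachA A k u w
  stable-≡ st zero    w = refl
  stable-≡ {k} st (suc j) w = trans (stable-+ {k} st j w) (stable-≡ {k} st j w)

  grows-or-stable : ∀ k → k < countᵇ (reachA A k u) (allFin n) ⊎ Stable k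
  grows-or-stable zero = inj₁ (countᵇ-pos (reachA A 0 u) (∈P.∈-allFin u) (==-refl u))
  grows-or-stable (suc k) with grows-or-stable k
  ... | inj₂ st = inj₂ (stable-suc {k} st)
  ... | inj₁ k<c with FinP.all? (λ w → reachA A (suc k) u w Bool.≟ reachA A k u w)
  ...   | yes st  = inj₂ (stable-suc {k} st)
  ...   | no ¬st with FinP.¬∀⟶∃¬ n _ (λ w → reachA A (suc k) u w Bool.≟ reachA A k u w) ¬st
  ...     | w , changed with implication-≢ (∨-introˡ _) changed
  ...       | now , before = inj₁ (ℕP.<-≤-trans (s≤s k<c)
                               (countᵇ-mono-< (λ _ → ∨-introˡ _) (∈P.∈-allFin w) before now))

  stable-n : Stable n
  stable-n with grows-or-stable n
  ... | inj₂ st  = st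
  ... | inj₁ n<c = ⊥-elim (ℕP.<-irrefl refl (ℕP.<-≤-trans n<c (ℕP.≤-trans (countᵇ≤length _ (allFin n))
                                                                   (ℕP.≤-reflexive (ListP.length-tabulate id)))))

reachA⇒connected : ∀ {n} (A : BoolRel n) k {u w} → reachA A k u w ≡ true → connected A u w ≡ true
reachA⇒connected {n} A k {u} {w} r =
  trans (sym (stable-≡ {n} stable-n k w)) (subst (λ j → reachA A j u w ≡ true) (ℕP.+-comm n k) (reachA-+ A n r))
  where open Stabilisation A u

module _ {n : ℕ} where

  Path⇒connected : {A : BoolRel n} → Path A ⇒ λ u w → connected A u w ≡ true
  Path⇒connected {A} p with Path⇒reachA A p
  ... | k , r = reachA⇒connected A k r

  connected⇒Path : {A : BoolRel n} → ∀ {u w} → connected A u w ≡ true → Path A u w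
  connected⇒Path {A} = reachA⇒Path A n

  connected-mono : {A B : BoolRel n} → A ⊆* B → ∀ {u w} → connected A u w ≡ true → connected B u w ≡ true
  connected-mono A⊆B = Path⇒connected ∘ (A⊆B ⋆) ∘ connected⇒Path

  connected-cong : {A B : BoolRel n} → A ≃* B → connected A ≗₂ connected B
  connected-cong (A⊆B , B⊆A) u w = bool-ext (connected-mono A⊆B) (connected-mono B⊆A)

  connected-sym : {A : BoolRel n} → SymmetricRel A → SymmetricRel (connected A)
  connected-sym sym-A u w = bool-ext (Path⇒connected ∘ Path-sym sym-A ∘ connected⇒Path)
                                     (Path⇒connected ∘ Path-sym sym-A ∘ connected⇒Path)

  connected-refl : (A : BoolRel n) → ∀ u → connected A u u ≡ true
  connected-refl A u = Path⇒connected {A} ε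

module FinSum {a ℓ} (M : CommutativeMonoid a ℓ) where
  open CommutativeMonoid M using (Carrier; _∙_) renaming (ε to 0#)
  open import Algebra.Properties.CommutativeMonoid.Sum M public using (sum; sum-remove; sum-cong-≋; sum-cong-≗)

  foldr-tabulate : ∀ {b} {Y : Set b} n (f : Y → Carrier) (g : Fin n → Y) →
                   foldr (λ y acc → f y ∙ acc) 0# (tabulate g) ≡ sum (f ∘ g)
  foldr-tabulate zero    f g = refl
  foldr-tabulate (suc n) f g = cong (f (g Fin.zero) ∙_) (foldr-tabulate n f (g ∘ Fin.suc))

  foldr-allFin : ∀ n (f : Fin n → Carrier) → foldr (λ x acc → f x ∙ acc) 0# (allFin n) ≡ sum f
  foldr-allFin n f = foldr-tabulate n f id

module ℕSum = FinSum ℕP.+-0-commutativeMonoid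
module ∨Sum = FinSum BoolP.∨-commutativeMonoid

any≡∨-sum : ∀ {n} (f : Fin n → Bool) → any f (allFin n) ≡ ∨Sum.sum f
any≡∨-sum {n} f = trans (ListP.foldr-map _∨_ f false (allFin n)) (∨Sum.foldr-allFin n f)

module RingProperties {c ℓ : Level} (R : CommutativeRing c ℓ) where

  private module Solved where
    -- no zero test is supplied; none is needed as nothing cancels
    R′ = fromCommutativeRing R (λ _ → nothing)
    open AlmostCommutativeRing R′

    -‿swap : ∀ a b c d → (a - b) - (c - d) ≈ (a - c) - (b - d)
    -‿swap = solve-∀ R′

  open Solved public using (-‿swap)
  open CommutativeRing R renaming (sym to ≈-sym; trans to ≈-trans)
  open import Algebra.Properties.Group +-group using (ε⁻¹≈ε)
  open import Algebra.Properties.AbelianGroup +-abelianGroup using (⁻¹-∙-comm)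
  open import Relation.Binary.Reasoning.Setoid setoid

  -‿cancel : ∀ a b → (a - b) - (b - b) ≈ a - b
  -‿cancel a b = begin
    (a - b) - (b - b)  ≈⟨ +-congˡ (-‿cong (-‿inverseʳ b)) ⟩
    (a - b) - 0#       ≈⟨ +-congˡ ε⁻¹≈ε ⟩
    (a - b) + 0#       ≈⟨ +-identityʳ _ ⟩
    a - b              ∎

  ∑ : ∀ {a} {Y : Set a} → (Y → Carrier) → List Y → Carrier
  ∑ g = foldr (λ y acc → g y + acc) 0#

  ∑-++ : ∀ {a} {Y : Set a} (g : Y → Carrier) xs ys → ∑ g (xs ++ ys) ≈ ∑ g xs + ∑ g ys
  ∑-++ g []       ys = ≈-sym (+-identityˡ _)
  ∑-++ g (x ∷ xs) ys = ≈-trans (+-congˡ (∑-++ g xs ys)) (≈-sym (+-assoc _ _ _))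

  ∑-neg : ∀ {a} {Y : Set a} {g h : Y → Carrier} → (∀ y → g y ≈ - h y) → ∀ xs → ∑ g xs ≈ - ∑ h xs
  ∑-neg g≈-h []       = ≈-sym ε⁻¹≈ε
  ∑-neg g≈-h (x ∷ xs) = ≈-trans (+-cong (g≈-h x) (∑-neg g≈-h xs)) (⁻¹-∙-comm _ _)

-- Weights and the alternating sum Ψ

module Weight {c ℓ : Level} (R : CommutativeRing c ℓ)
              (p : ℕ → CommutativeRing.Carrier R) (t : CommutativeRing.Carrier R)
              {n : ℕ} (v : Fin n) where
  open CommutativeRing R renaming (refl to ≈-refl; sym to ≈-sym; trans to ≈-trans; reflexive to ≈-reflexive)
  open RingProperties R
  open import Algebra.Properties.Ring ring using (-‿distribˡ-*)
  open import Relation.Binary.Reasoning.Setoid setoid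

  blockSize : BoolRel n → Fin n → ℕ
  blockSize C u = countᵇ (C u) (allFin n)

  isLeast : BoolRel n → Fin n → Bool
  isLeast C r = not (any (λ w → (toℕ w ℕ.<ᵇ toℕ r) ∧ C r w) (allFin n))

  blockFactor : BoolRel n → Fin n → Carrier
  blockFactor C r = if isLeast C r ∧ not (C v r) then p (blockSize C r) else 1#

  pType : BoolRel n → Carrier
  pType C = foldr (λ r acc → blockFactor C r * acc) 1# (allFin n)

  weight : BoolRel n → Carrier
  weight C = pType C * pow R t (blockSize C v ∸ 1)

  weight-cong : ∀ {C C′} → C ≗₂ C′ → weight C ≡ weight C′
  weight-cong {C} {C′} C≗C′ = cong₂ _*_ pType≡ (cong (λ k → pow R t (k ∸ 1)) (size≡ v))
    where
    size≡ : ∀ u → blockSize C u ≡ blockSize C′ u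
    size≡ u = ListP.foldr-cong (λ w acc → cong (λ b → bit b ℕ.+ acc) (C≗C′ u w)) refl (allFin n)
    least≡ : ∀ r → isLeast C r ≡ isLeast C′ r
    least≡ r = cong not (any-cong (λ w → cong ((toℕ w ℕ.<ᵇ toℕ r) ∧_) (C≗C′ r w)) (allFin n))
    factor≡ : ∀ r → blockFactor C r ≡ blockFactor C′ r
    factor≡ r = cong₂ (λ b k → if b then p k else 1#) (cong₂ (λ x y → x ∧ not y) (least≡ r) (C≗C′ v r)) (size≡ r)
    pType≡ : pType C ≡ pType C′
    pType≡ = ListP.foldr-cong (λ r acc → cong (_* acc) (factor≡ r)) refl (allFin n)

  connWeight : BoolRel n → Carrier
  connWeight A = weight (connected A)

  connWeight-cong : ∀ {A B} → A ≃* B → connWeight A ≡ connWeight B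
  connWeight-cong A≃B = weight-cong (connected-cong A≃B)

  -- Ψ A L = Σ_{S ⊆ L} (-1)^|S| connWeight (A ∪ ⋃ S)
  Ψ : BoolRel n → List (BoolRel n) → Carrier
  Ψ A []      = connWeight A
  Ψ A (x ∷ L) = Ψ A L - Ψ (A ∪ x) L

  Ψ-cong : ∀ {A B} → A ≃* B → ∀ L → Ψ A L ≈ Ψ B L
  Ψ-cong A≃B []      = ≈-reflexive (connWeight-cong A≃B)
  Ψ-cong A≃B (x ∷ L) = +-cong (Ψ-cong A≃B L) (-‿cong (Ψ-cong (∪-cong-≃* x A≃B) L))

  Ψ-∷-cong : ∀ L L′ → (∀ B → Ψ B L ≈ Ψ B L′) → ∀ A x → Ψ A (x ∷ L) ≈ Ψ A (x ∷ L′)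
  Ψ-∷-cong _ _ L≈L′ A x = +-cong (L≈L′ A) (-‿cong (L≈L′ (A ∪ x)))

  Ψ-swap : ∀ A x y L → Ψ A (x ∷ y ∷ L) ≈ Ψ A (y ∷ x ∷ L)
  Ψ-swap A x y L = begin
    (Ψ A L - Ψ (A ∪ y) L) - (Ψ (A ∪ x) L - Ψ ((A ∪ x) ∪ y) L)
      ≈⟨ -‿swap _ _ _ _ ⟩
    (Ψ A L - Ψ (A ∪ x) L) - (Ψ (A ∪ y) L - Ψ ((A ∪ x) ∪ y) L)
      ≈⟨ +-congˡ (-‿cong (+-congˡ (-‿cong (Ψ-cong (≗₂⇒≃* (∪-swapʳ A x y)) L)))) ⟩
    (Ψ A L - Ψ (A ∪ x) L) - (Ψ (A ∪ y) L - Ψ ((A ∪ y) ∪ x) L) ∎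

  Ψ-dup : ∀ {A x y} → x ∼⟨ A ⟩ y → ∀ L → Ψ A (x ∷ y ∷ L) ≈ Ψ A (x ∷ L)
  Ψ-dup {A} {x} {y} (y⊆ , x⊆) L = begin
    (Ψ A L - Ψ (A ∪ y) L) - (Ψ (A ∪ x) L - Ψ ((A ∪ x) ∪ y) L) ≈⟨ +-cong (+-congˡ (-‿cong (Ψ-cong y≃x L)))
                                                                        (-‿cong (+-congˡ (-‿cong (Ψ-cong xy≃x L)))) ⟩
    (Ψ A L - Ψ (A ∪ x) L) - (Ψ (A ∪ x) L - Ψ (A ∪ x) L)        ≈⟨ -‿cancel _ _ ⟩
    Ψ A L - Ψ (A ∪ x) L                                         ∎
    where
    y≃x : (A ∪ y) ≃* (A ∪ x)
    y≃x = ∪-⊆* (⊆*-∪ˡ A x) y⊆ , ∪-⊆* (⊆*-∪ˡ A y) x⊆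
    xy≃x : ((A ∪ x) ∪ y) ≃* (A ∪ x)
    xy≃x = ∪-⊆* return y⊆ , ⊆*-∪ˡ (A ∪ x) y

  Ψ-move : ∀ x L₁ L₂ A → Ψ A (L₁ ++ x ∷ L₂) ≈ Ψ A (x ∷ L₁ ++ L₂)
  Ψ-move x []       L₂ A = ≈-refl
  Ψ-move x (y ∷ L₁) L₂ A =
    ≈-trans (Ψ-∷-cong (L₁ ++ x ∷ L₂) (x ∷ L₁ ++ L₂) (Ψ-move x L₁ L₂) A y) (Ψ-swap A y x (L₁ ++ L₂))

  Ψ-++-comm : ∀ L M A → Ψ A (M ++ L) ≈ Ψ A (L ++ M)
  Ψ-++-comm L []      A = ≈-reflexive (cong (Ψ A) (sym (ListP.++-identityʳ L)))
  Ψ-++-comm L (y ∷ M) A = ≈-trans (Ψ-∷-cong (M ++ L) (L ++ M) (Ψ-++-comm L M) A y) (≈-sym (Ψ-move y L M A))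

  Ψ-redundant : ∀ {A x y L} → x ∈ L → x ∼⟨ A ⟩ y → Ψ A (y ∷ L) ≈ Ψ A L
  Ψ-redundant {A} {x} {y} x∈L x∼y with ∈P.∈-∃++ x∈L
  ... | L₁ , L₂ , refl = begin
    Ψ A (y ∷ L₁ ++ x ∷ L₂)  ≈⟨ Ψ-∷-cong (L₁ ++ x ∷ L₂) (x ∷ L₁ ++ L₂) (Ψ-move x L₁ L₂) A y ⟩
    Ψ A (y ∷ x ∷ L₁ ++ L₂)  ≈⟨ Ψ-swap A y x (L₁ ++ L₂) ⟩
    Ψ A (x ∷ y ∷ L₁ ++ L₂)  ≈⟨ Ψ-dup x∼y (L₁ ++ L₂) ⟩
    Ψ A (x ∷ L₁ ++ L₂)      ≈⟨ Ψ-move x L₁ L₂ A ⟨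
    Ψ A (L₁ ++ x ∷ L₂)      ∎

  Ψ-absorb : ∀ {A L} M → Covers A L M → Ψ A (M ++ L) ≈ Ψ A L
  Ψ-absorb []      cov = ≈-refl
  Ψ-absorb (y ∷ M) cov with cov (here refl)
  ... | x , x∈L , x∼y = ≈-trans (Ψ-redundant (∈P.∈-++⁺ʳ M x∈L) x∼y) (Ψ-absorb M (cov ∘ there))

  Ψ-covers : ∀ {A L M} → Covers A L M → Covers A M L → Ψ A L ≈ Ψ A M
  Ψ-covers {A} {L} {M} L⊒M M⊒L = begin
    Ψ A L        ≈⟨ Ψ-absorb M L⊒M ⟨
    Ψ A (M ++ L) ≈⟨ Ψ-++-comm L M A ⟩
    Ψ A (L ++ M) ≈⟨ Ψ-absorb L M⊒L ⟩
    Ψ A M        ∎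

  signedSum : BoolRel n → List (Fin n × Fin n) → Carrier
  signedSum A L = ∑ (λ S → sgn R (length S) * connWeight (A ∪ adjS S)) (sublists L)

  signedSum-∷ : ∀ A x L → signedSum A (x ∷ L) ≈ signedSum A L - signedSum (A ∪ edgeRel x) L
  signedSum-∷ A x L = begin
    ∑ term (sublists L ++ map (x ∷_) (sublists L))
      ≈⟨ ∑-++ term (sublists L) _ ⟩
    ∑ term (sublists L) + ∑ term (map (x ∷_) (sublists L))
      ≡⟨ cong (∑ term (sublists L) +_) (ListP.foldr-map _ (x ∷_) 0# (sublists L)) ⟩
    ∑ term (sublists L) + ∑ (term ∘ (x ∷_)) (sublists L)
      ≈⟨ +-congˡ (∑-neg term-∷ (sublists L)) ⟩
    signedSum A L - signedSum (A ∪ edgeRel x) L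
      ∎
    where
    term : List (Fin n × Fin n) → Carrier
    term S = sgn R (length S) * connWeight (A ∪ adjS S)
    term-∷ : ∀ S → term (x ∷ S) ≈ - (sgn R (length S) * connWeight ((A ∪ edgeRel x) ∪ adjS S))
    term-∷ S = ≈-trans (*-congˡ (≈-reflexive (connWeight-cong (≗₂⇒≃* λ a b →
                 sym (BoolP.∨-assoc (A a b) (edgeRel x a b) (adjS S a b))))))
               (≈-sym (-‿distribˡ-* _ _))

  signedSum≈Ψ : ∀ L A → signedSum A L ≈ Ψ A (map edgeRel L)
  signedSum≈Ψ []      A = ≈-trans (+-identityʳ _) (≈-trans (*-identityˡ _)
                            (≈-reflexive (connWeight-cong (≗₂⇒≃* λ a b → BoolP.∨-identityʳ (A a b)))))
  signedSum≈Ψ (x ∷ L) A = ≈-trans (signedSum-∷ A x L)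
                            (+-cong (signedSum≈Ψ L A) (-‿cong (signedSum≈Ψ L (A ∪ edgeRel x))))

  X≈Ψ : (G : Graph n) → X R p t G v ≈ Ψ ∅ (map edgeRel (edges G))
  X≈Ψ G = ≈-trans (≈-reflexive (ListP.foldr-cong (λ S acc → cong (λ W → sgn R (length S) * W + acc)
                                   (weight-cong (reach≡reachA S n))) refl (sublists (edges G))))
                  (signedSum≈Ψ (edges G) ∅)

module EdgeList {n : ℕ} (G : Graph n) where

  listed : Fin n → Fin n → Bool
  listed i j = (toℕ i ℕ.<ᵇ toℕ j) ∧ adj G i j

  ∈-edges⁻ : ∀ {i j} → (i , j) ∈ edges G → listed i j ≡ true
  ∈-edges⁻ {i} {j} ij∈ with Any.satisfied (∈P.∈-concatMap⁻ _ {xs = allFin n} ij∈)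
  ... | i′ , ij∈row with Any.satisfied (∈P.∈-concatMap⁻ _ {xs = allFin n} ij∈row)
  ... | j′ , ij∈cell with listed i′ j′ in eq | ij∈cell
  ...   | true | here refl = eq

  ∈-edges⁺ : ∀ {i j} → listed i j ≡ true → (i , j) ∈ edges G
  ∈-edges⁺ {i} {j} l = ∈P.∈-concatMap⁺ _ {xs = allFin n} (lose (∈P.∈-allFin i)
                        (∈P.∈-concatMap⁺ _ {xs = allFin n} (lose (∈P.∈-allFin j) ij∈cell)))
    where
    ij∈cell : (i , j) ∈ (if listed i j then (i , j) ∷ [] else [])
    ij∈cell rewrite l = here refl

  adj⇒∈-edges : ∀ {i j} → adj G i j ≡ true → ∃[ x ] x ∈ edges G × edgeRel x ≗₂ edgeRel (i , j)
  adj⇒∈-edges {i} {j} e with ℕP.<-cmp (toℕ i) (toℕ j)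
  ... | tri< i<j _ _ = (i , j) , ∈-edges⁺ (∧-intro (T⇒≡ (ℕP.<⇒<ᵇ i<j)) e) , λ _ _ → refl
  ... | tri≈ _ i≡j _ = ⊥-elim (adj⇒≢ G e (FinP.toℕ-injective i≡j))
  ... | tri> _ _ j<i = (j , i) , ∈-edges⁺ (∧-intro (T⇒≡ (ℕP.<⇒<ᵇ j<i)) (trans (adj-sym G j i) e)) , edgeRel-flip j i

-- Contracting the edge {v,w}

punchIn-<ᵇ : ∀ {m} (w : Fin (suc m)) (z y : Fin m) → (toℕ (punchIn w z) ℕ.<ᵇ toℕ (punchIn w y)) ≡ (toℕ z ℕ.<ᵇ toℕ y)
punchIn-<ᵇ Fin.zero z y = refl
punchIn-<ᵇ {suc m} (Fin.suc w) Fin.zero     Fin.zero     = refl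
punchIn-<ᵇ {suc m} (Fin.suc w) Fin.zero     (Fin.suc y)  = refl
punchIn-<ᵇ {suc m} (Fin.suc w) (Fin.suc z)  Fin.zero     = refl
punchIn-<ᵇ {suc m} (Fin.suc w) (Fin.suc z)  (Fin.suc y)  = punchIn-<ᵇ w z y

module Quotient {m : ℕ} (v w : Fin (suc m)) (v≢w : v ≢ w) where

  π : Fin (suc m) → Fin m
  π = quot v w v≢w

  π-punchIn : ∀ y → π (punchIn w y) ≡ y
  π-punchIn y with punchIn w y Fin.≟ w
  ... | yes eq = ⊥-elim (FinP.punchInᵢ≢i w y eq)
  ... | no _   = trans (FinP.punchOut-cong w refl) (FinP.punchOut-punchIn w)

  π-w : π w ≡ π v
  π-w with w Fin.≟ w | v Fin.≟ w
  ... | no w≢w | _      = ⊥-elim (w≢w refl)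
  ... | yes _  | yes eq = ⊥-elim (v≢w eq)
  ... | yes _  | no _   = FinP.punchOut-cong w refl

  π-fiber : ∀ {a b} → π a ≡ π b → a ≡ b ⊎ (a ≡ v × b ≡ w) ⊎ (a ≡ w × b ≡ v)
  π-fiber {a} {b} eq with a Fin.≟ w | b Fin.≟ w
  ... | yes a≡w | yes b≡w = inj₁ (trans a≡w (sym b≡w))
  ... | yes a≡w | no b≢w  = inj₂ (inj₂ (a≡w , sym (FinP.punchOut-injective (v≢w ∘ sym) (b≢w ∘ sym) eq)))
  ... | no a≢w  | yes b≡w = inj₂ (inj₁ (FinP.punchOut-injective (a≢w ∘ sym) (v≢w ∘ sym) eq , b≡w))
  ... | no a≢w  | no b≢w  = inj₁ (FinP.punchOut-injective (a≢w ∘ sym) (b≢w ∘ sym) eq)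

  π-edge : ∀ {a b} → edgeRel (v , w) a b ≡ true → π a ≡ π b
  π-edge {a} {b} e with edgeRel-elim {i = v} {w} {a} {b} e
  ... | inj₁ (refl , refl) = sym π-w
  ... | inj₂ (refl , refl) = π-w

  fiber-Path : ∀ {A} → edgeRel (v , w) ⊆* A → ∀ {a b} → π a ≡ π b → Path A a b
  fiber-Path vw⊆A {a} {b} eq with π-fiber {a} {b} eq
  ... | inj₁ refl                = ε
  ... | inj₂ (inj₁ (refl , refl)) = vw⊆A (edgeRel-introˡ v w)
  ... | inj₂ (inj₂ (refl , refl)) = vw⊆A (edgeRel-introʳ v w)

  lift : BoolRel m → BoolRel (suc m)
  lift B′ = (λ a b → B′ (π a) (π b)) ∪ edgeRel (v , w)

  liftRel : Fin m × Fin m → BoolRel (suc m)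
  liftRel x a b = edgeRel x (π a) (π b)

  module _ (B′ : BoolRel m) where

    lift-Path⇒Path : ∀ {a b} → Path (lift B′) a b → Path B′ (π a) (π b)
    lift-Path⇒Path = kleisliStar π project
      where
      project : ∀ {a b} → Edge (lift B′) a b → Path B′ (π a) (π b)
      project {a} {b} e with ∨-elim (B′ (π a) (π b)) e
      ... | inj₁ e′ = return e′
      ... | inj₂ vw = subst (Path B′ (π a)) (π-edge vw) ε

    Path⇒lift-Path : ∀ {a′ b′} → Path B′ a′ b′ → ∀ {a b} → π a ≡ a′ → π b ≡ b′ → Path (lift B′) a b
    Path⇒lift-Path ε a↦ b↦ = fiber-Path (⊆*-∪ʳ (λ a b → B′ (π a) (π b)) (edgeRel (v , w))) (trans a↦ (sym b↦))
    Path⇒lift-Path (_◅_ {j = x′} e es) {a} refl b↦ =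
      ∨-introˡ (edgeRel (v , w) a (punchIn w x′)) (subst (λ x → B′ (π a) x ≡ true) (sym (π-punchIn x′)) e)
      ◅ Path⇒lift-Path es (π-punchIn x′) b↦

    connected-lift : ∀ a b → connected (lift B′) a b ≡ connected B′ (π a) (π b)
    connected-lift a b = bool-ext (Path⇒connected ∘ lift-Path⇒Path ∘ connected⇒Path)
                                  (λ c → Path⇒connected (Path⇒lift-Path (connected⇒Path c) refl refl))

  edgeRel∼liftRel : ∀ x y → edgeRel (x , y) ∼⟨ ∅ ∪ edgeRel (v , w) ⟩ liftRel (π x , π y)
  edgeRel∼liftRel x y = image⊆ , edge⊆
    where
    E = ∅ ∪ edgeRel (v , w)
    fiber : ∀ {a b} → π a ≡ π b → Path (E ∪ edgeRel (x , y)) a b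
    fiber = fiber-Path (⊆*-trans (⊆*-∪ʳ ∅ (edgeRel (v , w))) (⊆*-∪ˡ E (edgeRel (x , y))))
    edge⊆ : edgeRel (x , y) ⊆* (E ∪ liftRel (π x , π y))
    edge⊆ {a} {b} xy = return (∨-introʳ (E a b) (edgeRel-map π {x} {y} {a} {b} xy))
    image⊆ : liftRel (π x , π y) ⊆* (E ∪ edgeRel (x , y))
    image⊆ {a} {b} xy′ with edgeRel-elim {i = π x} {π y} {π a} {π b} xy′
    ... | inj₁ (x↦a , y↦b) = fiber (sym x↦a) ◅◅ return (∨-introʳ (E x y) (edgeRel-introˡ x y)) ◅◅ fiber y↦b
    ... | inj₂ (x↦b , y↦a) = fiber (sym y↦a) ◅◅ return (∨-introʳ (E y x) (edgeRel-introʳ x y)) ◅◅ fiber x↦b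

module Contraction {c ℓ : Level} (R : CommutativeRing c ℓ)
                   (p : ℕ → CommutativeRing.Carrier R) (t : CommutativeRing.Carrier R)
                   {m : ℕ} (v w : Fin (suc m)) (v≢w : v ≢ w) where
  open CommutativeRing R renaming (refl to ≈-refl; sym to ≈-sym; trans to ≈-trans; reflexive to ≈-reflexive)
  open import Algebra.Properties.Ring ring using (x[y-z]≈xy-xz)
  open import Algebra.Properties.CommutativeSemigroup *-commutativeSemigroup using (x∙yz≈y∙xz)
  module ≈-Reasoning = Relation.Binary.Reasoning.Setoid setoid
  open Quotient v w v≢w
  module WG = Weight R p t v
  module WH = Weight R p t (π v)
  module ∏ = FinSum *-commutativeMonoid

  pow-pred : ∀ k → 0 < k → pow R t (suc k ∸ 1) ≡ t * pow R t (k ∸ 1)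
  pow-pred (suc k) _ = refl

  module _ (C : BoolRel (suc m)) (C′ : BoolRel m) (C≡C′∘π : ∀ a b → C a b ≡ C′ (π a) (π b))
           (sym-C′ : SymmetricRel C′) (refl-C′ : ∀ x → C′ x x ≡ true) where

    C-vw : C v w ≡ true
    C-vw = trans (C≡C′∘π v w) (trans (cong (C′ (π v)) π-w) (refl-C′ (π v)))

    C-punchIn : ∀ u y → C u (punchIn w y) ≡ C′ (π u) y
    C-punchIn u y = trans (C≡C′∘π u _) (cong (C′ (π u)) (π-punchIn y))

    C-w : ∀ y → C (punchIn w y) w ≡ C v (punchIn w y)
    C-w y = trans (C≡C′∘π _ w) (trans (cong₂ C′ (π-punchIn y) π-w) (trans (sym-C′ y (π v)) (sym (C-punchIn v y))))

    blockSize-π : ∀ u → WG.blockSize C u ≡ bit (C u w) ℕ.+ WH.blockSize C′ (π u)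
    blockSize-π u = begin
      WG.blockSize C u
        ≡⟨ ℕSum.foldr-allFin (suc m) (bit ∘ C u) ⟩
      ℕSum.sum (bit ∘ C u)
        ≡⟨ ℕSum.sum-remove {i = w} (bit ∘ C u) ⟩
      bit (C u w) ℕ.+ ℕSum.sum (bit ∘ C u ∘ punchIn w)
        ≡⟨ cong (bit (C u w) ℕ.+_) (ℕSum.sum-cong-≗ (cong bit ∘ C-punchIn u)) ⟩
      bit (C u w) ℕ.+ ℕSum.sum (bit ∘ C′ (π u))
        ≡⟨ cong (bit (C u w) ℕ.+_) (ℕSum.foldr-allFin m (bit ∘ C′ (π u))) ⟨
      bit (C u w) ℕ.+ WH.blockSize C′ (π u)
        ∎
      where open ≡-Reasoning

    isLeast-punchIn : ∀ y → C v (punchIn w y) ≡ false → WG.isLeast C (punchIn w y) ≡ WH.isLeast C′ y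
    isLeast-punchIn y v≁y = cong not (begin
      any earlier (allFin (suc m))                   ≡⟨ any≡∨-sum earlier ⟩
      ∨Sum.sum earlier                               ≡⟨ ∨Sum.sum-remove {i = w} earlier ⟩
      earlier w ∨ ∨Sum.sum (earlier ∘ punchIn w)      ≡⟨ cong₂ _∨_ w-not-earlier (∨Sum.sum-cong-≗ earlier-punchIn) ⟩
      ∨Sum.sum earlier′                              ≡⟨ any≡∨-sum earlier′ ⟨
      any earlier′ (allFin m)                        ∎)
      where
      open ≡-Reasoning
      earlier : Fin (suc m) → Bool
      earlier x = (toℕ x ℕ.<ᵇ toℕ (punchIn w y)) ∧ C (punchIn w y) x
      earlier′ : Fin m → Bool
      earlier′ z = (toℕ z ℕ.<ᵇ toℕ y) ∧ C′ y z
      w-not-earlier : earlier w ≡ false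
      w-not-earlier = trans (cong (_ ∧_) (trans (C-w y) v≁y)) (BoolP.∧-zeroʳ _)
      earlier-punchIn : ∀ z → earlier (punchIn w z) ≡ earlier′ z
      earlier-punchIn z = cong₂ _∧_ (punchIn-<ᵇ w z y) (trans (C-punchIn (punchIn w y) z) (cong (λ u → C′ u z) (π-punchIn y)))

    blockFactor-w : WG.blockFactor C w ≡ 1#
    blockFactor-w rewrite C-vw | BoolP.∧-zeroʳ (WG.isLeast C w) = refl

    blockFactor-punchIn : ∀ y → WG.blockFactor C (punchIn w y) ≡ WH.blockFactor C′ y
    blockFactor-punchIn y rewrite C-punchIn v y with C′ (π v) y in vy
    ... | true  rewrite BoolP.∧-zeroʳ (WG.isLeast C (punchIn w y)) | BoolP.∧-zeroʳ (WH.isLeast C′ y) = refl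
    ... | false rewrite isLeast-punchIn y (trans (C-punchIn v y) vy)
                      | blockSize-π (punchIn w y) | C-w y | C-punchIn v y | vy | π-punchIn y = refl

    pType-π : WG.pType C ≈ WH.pType C′
    pType-π = begin
      WG.pType C                                          ≡⟨ ∏.foldr-allFin (suc m) (WG.blockFactor C) ⟩
      ∏.sum (WG.blockFactor C)                            ≈⟨ ∏.sum-remove {i = w} (WG.blockFactor C) ⟩
      WG.blockFactor C w * ∏.sum (WG.blockFactor C ∘ punchIn w) ≈⟨ *-cong (≈-reflexive blockFactor-w)
                                                                     (∏.sum-cong-≋ (≈-reflexive ∘ blockFactor-punchIn)) ⟩
      1# * ∏.sum (WH.blockFactor C′)                      ≈⟨ *-identityˡ _ ⟩
      ∏.sum (WH.blockFactor C′)                           ≡⟨ ∏.foldr-allFin m (WH.blockFactor C′) ⟨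
      WH.pType C′                                         ∎
      where open ≈-Reasoning

    weight-π : WG.weight C ≈ t * WH.weight C′
    weight-π = begin
      WG.pType C * pow R t (WG.blockSize C v ∸ 1)                ≡⟨ cong (λ k → WG.pType C * pow R t (k ∸ 1)) size-v ⟩
      WG.pType C * pow R t (suc (WH.blockSize C′ (π v)) ∸ 1)      ≡⟨ cong (WG.pType C *_) (pow-pred _ v-counted) ⟩
      WG.pType C * (t * pow R t (WH.blockSize C′ (π v) ∸ 1))      ≈⟨ *-congʳ pType-π ⟩
      WH.pType C′ * (t * pow R t (WH.blockSize C′ (π v) ∸ 1))     ≈⟨ x∙yz≈y∙xz _ _ _ ⟩
      t * WH.weight C′                                           ∎
      where
      open ≈-Reasoning
      size-v : WG.blockSize C v ≡ suc (WH.blockSize C′ (π v))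
      size-v = trans (blockSize-π v) (cong (λ b → bit b ℕ.+ _) C-vw)
      v-counted : 0 < WH.blockSize C′ (π v)
      v-counted = countᵇ-pos (C′ (π v)) (∈P.∈-allFin (π v)) (refl-C′ (π v))

  connWeight-lift : ∀ B′ → SymmetricRel B′ → WG.connWeight (lift B′) ≈ t * WH.connWeight B′
  connWeight-lift B′ sym-B′ = weight-π (connected (lift B′)) (connected B′) (connected-lift B′)
                                       (connected-sym sym-B′) (connected-refl B′)

  Ψ-lift : ∀ L′ B′ → SymmetricRel B′ → WG.Ψ (lift B′) (map liftRel L′) ≈ t * WH.Ψ B′ (map edgeRel L′)
  Ψ-lift []       B′ sym-B′ = connWeight-lift B′ sym-B′
  Ψ-lift (x ∷ L′) B′ sym-B′ = begin
    WG.Ψ (lift B′) (map liftRel L′) - WG.Ψ (lift B′ ∪ liftRel x) (map liftRel L′)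
      ≈⟨ +-cong (Ψ-lift L′ B′ sym-B′)
                (-‿cong (≈-trans (WG.Ψ-cong (≗₂⇒≃* lift-∪) (map liftRel L′))
                                 (Ψ-lift L′ (B′ ∪ edgeRel x) sym-B′∪x))) ⟩
    t * WH.Ψ B′ (map edgeRel L′) - t * WH.Ψ (B′ ∪ edgeRel x) (map edgeRel L′)
      ≈⟨ x[y-z]≈xy-xz _ _ _ ⟨
    t * WH.Ψ B′ (map edgeRel (x ∷ L′)) ∎
    where
    open ≈-Reasoning
    lift-∪ : (lift B′ ∪ liftRel x) ≗₂ lift (B′ ∪ edgeRel x)
    lift-∪ = ∪-swapʳ (λ a b → B′ (π a) (π b)) (edgeRel (v , w)) (liftRel x)
    sym-B′∪x : SymmetricRel (B′ ∪ edgeRel x)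
    sym-B′∪x a b = cong₂ _∨_ (sym-B′ a b) (edgeRel-sym x a b)

module EdgeLists {m : ℕ} (G : Graph (suc m)) {v w : Fin (suc m)} (e : adj G v w ≡ true) where
  open Quotient v w (adj⇒≢ G e)

  D : Graph (suc m)
  D = delete G v w

  H : Graph m
  H = contract G v w e

  vw : BoolRel (suc m)
  vw = edgeRel (v , w)

  module EG = EdgeList G
  module ED = EdgeList D
  module EH = EdgeList H

  isEdge⇒π≡ : ∀ {x y} → isEdge v w x y ≡ true → π x ≡ π y
  isEdge⇒π≡ {x} {y} vw with edgeRel-elim {i = x} {y} {v} {w} vw
  ... | inj₁ (refl , refl) = sym π-w
  ... | inj₂ (refl , refl) = π-w

  adj-delete : ∀ {x y} → adj G x y ≡ true → π x ≢ π y → adj D x y ≡ true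
  adj-delete {x} {y} xy πx≢πy with isEdge v w x y in vw
  ... | true  = ⊥-elim (πx≢πy (isEdge⇒π≡ {x} {y} vw))
  ... | false = ∧-intro xy refl

  through : Fin m → Fin m → Bool
  through a′ b′ = any (λ x → any (λ y → adj G x y ∧ ((π x == a′) ∧ (π y == b′))) (allFin (suc m))) (allFin (suc m))

  through⁻ : ∀ {a′ b′} → through a′ b′ ≡ true → ∃[ x ] ∃[ y ] adj G x y ≡ true × π x ≡ a′ × π y ≡ b′
  through⁻ {a′} {b′} th with any-elim _ (allFin (suc m)) th
  ... | x , th′ with any-elim _ (allFin (suc m)) th′
  ...   | y , xy = x , y , ∧-elimˡ (adj G x y) xy , ==⇒≡ (∧-elimˡ (π x == a′) images) , ==⇒≡ (∧-elimʳ (π x == a′) images)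
    where images = ∧-elimʳ (adj G x y) xy

  through⁺ : ∀ {x y} → adj G x y ≡ true → through (π x) (π y) ≡ true
  through⁺ {x} {y} xy =
    any-intro _ (∈P.∈-allFin x) (any-intro _ (∈P.∈-allFin y) (∧-intro xy (∧-intro (==-refl (π x)) (==-refl (π y)))))

  adj-contract⁻ : ∀ {a′ b′} → adj H a′ b′ ≡ true → ∃[ x ] ∃[ y ] adj G x y ≡ true × π x ≡ a′ × π y ≡ b′
  adj-contract⁻ {a′} {b′} ab with ∨-elim (through a′ b′) (∧-elimʳ (not (a′ == b′)) ab)
  ... | inj₁ th = through⁻ th
  ... | inj₂ th with through⁻ th
  ...   | x , y , xy , x↦b , y↦a = y , x , trans (adj-sym G y x) xy , y↦a , x↦b

  adj-contract⁺ : ∀ {x y} → adj G x y ≡ true → π x ≢ π y → adj H (π x) (π y) ≡ true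
  adj-contract⁺ {x} {y} xy πx≢πy = ∧-intro (cong not (≢⇒== πx≢πy)) (∨-introˡ _ (through⁺ xy))

  π-separates : ∀ {x y} → adj D x y ≡ true → π x ≢ π y
  π-separates {x} {y} xy πx≡πy with π-fiber {x} {y} πx≡πy
  ... | inj₁ refl                 = false≢true (trans (sym (adj-irr D x)) xy)
  ... | inj₂ (inj₁ (refl , refl)) = false≢true (trans (cong not (sym (edgeRel-introˡ v w))) (∧-elimʳ (adj G v w) xy))
  ... | inj₂ (inj₂ (refl , refl)) = false≢true (trans (cong not (sym (edgeRel-introʳ w v))) (∧-elimʳ (adj G w v) xy))

  isEdge⇒vw≗ : ∀ {i j} → isEdge v w i j ≡ true → vw ≗₂ edgeRel (i , j)
  isEdge⇒vw≗ {i} {j} ij=vw with edgeRel-elim {i = i} {j} {v} {w} ij=vw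
  ... | inj₁ (refl , refl) = λ _ _ → refl
  ... | inj₂ (refl , refl) = edgeRel-flip v w

  G-covers-delete : Covers ∅ (map edgeRel (edges G)) (vw ∷ map edgeRel (edges D))
  G-covers-delete (here refl) with EG.adj⇒∈-edges e
  ... | x , x∈ , x≗vw = edgeRel x , ∈P.∈-map⁺ edgeRel x∈ , ≗₂⇒∼ {A = ∅} x≗vw
  G-covers-delete (there y∈) with ∈P.∈-map⁻ edgeRel y∈
  ... | (i , j) , ij∈ , refl = edgeRel (i , j) , ∈P.∈-map⁺ edgeRel (EG.∈-edges⁺ {i} {j} listed-G) , ∼-refl {A = ∅}
    where
    listed-D = ED.∈-edges⁻ ij∈
    listed-G = ∧-intro (∧-elimˡ (toℕ i ℕ.<ᵇ toℕ j) listed-D)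
                       (∧-elimˡ (adj G i j) (∧-elimʳ (toℕ i ℕ.<ᵇ toℕ j) listed-D))

  delete-covers-G : Covers ∅ (vw ∷ map edgeRel (edges D)) (map edgeRel (edges G))
  delete-covers-G x∈ with ∈P.∈-map⁻ edgeRel x∈
  ... | (i , j) , ij∈ , refl with isEdge v w i j in ij=vw
  ...   | true  = vw , here refl , ≗₂⇒∼ {A = ∅} (isEdge⇒vw≗ {i} {j} ij=vw)
  ...   | false = edgeRel (i , j) , there (∈P.∈-map⁺ edgeRel (ED.∈-edges⁺ {i} {j} listed-D)) , ∼-refl {A = ∅}
    where
    listed-G = EG.∈-edges⁻ ij∈
    listed-D = ∧-intro (∧-elimˡ (toℕ i ℕ.<ᵇ toℕ j) listed-G)
                       (∧-intro (∧-elimʳ (toℕ i ℕ.<ᵇ toℕ j) listed-G) (cong not ij=vw))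

  contract-edge-covered : ∀ {a′ b′} → adj H a′ b′ ≡ true →
                  ∃[ x ] x ∈ map edgeRel (edges D) × x ∼⟨ ∅ ∪ vw ⟩ liftRel (a′ , b′)
  contract-edge-covered {a′} {b′} ab with adj-contract⁻ ab
  ... | x , y , xy , x↦a , y↦b with ED.adj⇒∈-edges (adj-delete xy (λ eq → adj⇒≢ H ab (trans (sym x↦a) (trans eq y↦b))))
  ...   | z , z∈ , z≗xy =
    edgeRel z , ∈P.∈-map⁺ edgeRel z∈ ,
    ∼-respʳ {A = ∅ ∪ vw} {edgeRel z} {liftRel (π x , π y)} {liftRel (a′ , b′)}
      (λ a b → cong₂ (λ a″ b″ → edgeRel (a″ , b″) (π a) (π b)) x↦a y↦b)
      (∼-respˡ {A = ∅ ∪ vw} {edgeRel (x , y)} {edgeRel z} {liftRel (π x , π y)} (λ a b → sym (z≗xy a b)) (edgeRel∼liftRel x y))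

  delete-covers-contract : Covers (∅ ∪ vw) (map edgeRel (edges D)) (map liftRel (edges H))
  delete-covers-contract y∈ with ∈P.∈-map⁻ liftRel y∈
  ... | (a′ , b′) , ab∈ , refl = contract-edge-covered (∧-elimʳ (toℕ a′ ℕ.<ᵇ toℕ b′) (EH.∈-edges⁻ ab∈))

  delete-edge-covered : ∀ {i j} → adj D i j ≡ true →
                ∃[ y ] y ∈ map liftRel (edges H) × y ∼⟨ ∅ ∪ vw ⟩ edgeRel (i , j)
  delete-edge-covered {i} {j} ij with EH.adj⇒∈-edges (adj-contract⁺ {i} {j} (∧-elimˡ (adj G i j) ij) (π-separates {i} {j} ij))
  ... | z , z∈ , z≗ij =
    liftRel z , ∈P.∈-map⁺ liftRel z∈ ,
    ∼-respˡ {A = ∅ ∪ vw} {liftRel (π i , π j)} {liftRel z} {edgeRel (i , j)} (λ a b → sym (z≗ij (π a) (π b)))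
      (∼-sym {A = ∅ ∪ vw} {edgeRel (i , j)} {liftRel (π i , π j)} (edgeRel∼liftRel i j))

  contract-covers-delete : Covers (∅ ∪ vw) (map liftRel (edges H)) (map edgeRel (edges D))
  contract-covers-delete x∈ with ∈P.∈-map⁻ edgeRel x∈
  ... | (i , j) , ij∈ , refl = delete-edge-covered (∧-elimʳ (toℕ i ℕ.<ᵇ toℕ j) (ED.∈-edges⁻ ij∈))

lemma3p5 : ∀ {m} (G : Graph (suc m)) (v w : Fin (suc m)) (e : adj G v w ≡ true)
           {c ℓ} (R : CommutativeRing c ℓ)
           (p : ℕ → CommutativeRing.Carrier R) (t : CommutativeRing.Carrier R) →
           CommutativeRing._≈_ R
             (X R p t G v)
             (CommutativeRing._-_ R
               (X R p t (delete G v w) v)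
               (CommutativeRing._*_ R t (X R p t (contract G v w e) (quot v w (adj⇒≢ G e) v))))
lemma3p5 G v w e R p t = begin
  X R p t G v
    ≈⟨ WG.X≈Ψ G ⟩
  WG.Ψ ∅ (map edgeRel (edges G))
    ≈⟨ WG.Ψ-covers G-covers-delete delete-covers-G ⟩
  WG.Ψ ∅ LD - WG.Ψ (∅ ∪ vw) LD
    ≈⟨ +-cong (≈-sym (WG.X≈Ψ D)) (-‿cong (WG.Ψ-covers delete-covers-contract contract-covers-delete)) ⟩
  X R p t D v - WG.Ψ (lift ∅) (map liftRel (edges H))
    ≈⟨ +-congˡ (-‿cong (Ψ-lift (edges H) ∅ (λ _ _ → refl))) ⟩
  X R p t D v - t * WH.Ψ ∅ (map edgeRel (edges H))
    ≈⟨ +-congˡ (-‿cong (*-congˡ (≈-sym (WH.X≈Ψ H)))) ⟩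
  X R p t D v - t * X R p t H (π v)
    ∎
  where
  open CommutativeRing R using (_+_; _*_; _-_; -‿cong; +-cong; +-congˡ; *-congˡ; setoid) renaming (sym to ≈-sym)
  open Relation.Binary.Reasoning.Setoid setoid
  open Quotient v w (adj⇒≢ G e)
  open EdgeLists G e
  open Contraction R p t v w (adj⇒≢ G e)
  LD = map edgeRel (edges D)
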